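{- Let $G=B(m;a,S,b)$ be a connected bicirculant graph with $m>5$, $|S|\ge 2$, $\gcd(m,S)>1$, $a,b\ne m/2$, both $a$ and $b$ coprime to $\gcd(m,S)$, and $b\not\equiv \pm a \pmod{\gcd(m,S)}$. Then $G$ admits a $(\lambda,\mu,\rho)$-non-uniform representation with $\lambda\ge 1$, $1<\mu<\gcd(m,S)$ and $0\le\rho<\lambda$. Moreover, such parameters can be obtained as follows: let $h$ be the solution of $b\equiv ha \pmod{\gcd(m,S)}$ with $1<h<\gcd(m,S)-1$, and let $h^*=\min\{h,\gcd(m,S)-h\}$; then $\lambda=h^*-1$, and $\mu$ and $\rho+1$ are the quotient and remainder of the division of $\gcd(m,S)$ by $h^*$, i.e. $\gcd(m,S)=\mu h^*+\rho+1$.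
   Context: For an integer $m\ge 1$ and sets $R,S,T\subseteq \mathbb{Z}_m$ with $R=-R$, $T=-T$, $0\notin R\cup T$, $0\in S$, the bicirculant $B(m;R,S,T)$ has vertices $u_0,\dots,u_{m-1}$ (outer) and $v_0,\dots,v_{m-1}$ (inner) and edges $u_iu_{i+j}$ ($j\in R$, outer edges of type $j$), $v_iv_{i+j}$ ($j\in T$, inner edges of type $j$), $u_iv_{i+j}$ ($j\in S$, spokes), indices mod $m$. $B(m;a,S,b)$ denotes $B(m;\{a,-a\},S,\{b,-b\})$ with $a,b\ne 0$. $H(m;S)=B(m;\emptyset,S,\emptyset)$; it has $\gcd(m,S)$ connected components, where $\gcd(m,S)$ is the gcd of $m$ and all elements of $S$. Non-uniform representation: let $G=B(m;a,S,b)$ with $m>5$, $|S|\ge2$, $\gcd(m,S)>1$, $a,b\ne m/2$, and $a,b$ coprime to $\gcd(m,S)$. Let $\lambda,\mu$ be positive integers and $\rho$ an integer with $0\le\rho<\lambda$ and $(\rho+1)(\mu+1)+(\lambda-\rho)\mu=\gcd(m,S)$. $G$ has a $(\lambda,\mu,\rho)$-non-uniform representation if, for some sign $\varepsilon\in\{1,-1\}$, the connected components of $H(m;S)$ can be bijectively labelled $H_{i,j}$ for index pairs with $0\le i\le\mu,\ 0\le j\le\rho$ or $0\le i\le\mu-1,\ \rho+1\le j\le\lambda$, such that $u_0\in H_{0,0}$; whenever $0\le i\le\mu-1, 0\le j\le\lambda-1$, or $i=\mu, 0\le j\le\rho-1$, every outer vertex $u_x\in H_{i,j}$ has $u_{x+a}\in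 H_{i,j+1}$; and whenever $0\le i\le\mu-2, 0\le j\le\lambda$, or $i=\mu-1, 0\le j\le\rho$, every inner vertex $v_x\in H_{i,j}$ has $v_{x+\varepsilon b}\in H_{i+1,j}$. -}

module Defs where

open import Data.Nat using (ℕ; zero; suc; _+_; _*_; _∸_; _<_; _≤_; NonZero)
open import Data.Nat.DivMod using (_mod_)
open import Data.Nat.GCD using (gcd)
open import Data.Fin using (Fin; toℕ) renaming (zero to fzero)
open import Data.Fin.Subset using (Subset; _∈_; ⁅_⁆; _∪_; ⊥)
open import Data.Fin.Subset.Properties using (_∈?_)
open import Data.List using (List; foldr; map; filter; allFin)
open import Data.Product using (_×_; _,_; ∃)
open import Data.Sum using (_⊎_)
open import Data.Sign using (Sign)
open import Data.Integer as ℤ using (ℤ)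
open import Data.Integer.Divisibility as ℤD using ()
open import Relation.Binary.PropositionalEquality using (_≡_)
open import Relation.Binary.Construct.Closure.ReflexiveTransitive using (Star)

_⊕_ : ∀ {m} {{_ : NonZero m}} → Fin m → Fin m → Fin m
x ⊕ y = (toℕ x + toℕ y) mod _

⊖_ : ∀ {m} {{_ : NonZero m}} → Fin m → Fin m
⊖_ {m} x = (m ∸ toℕ x) mod m

0ₘ : ∀ {m} {{_ : NonZero m}} → Fin m
0ₘ = 0 mod _

±_ : ∀ {m} {{_ : NonZero m}} → Fin m → Subset m
± a = ⁅ a ⁆ ∪ ⁅ ⊖ a ⁆

signed : ∀ {m} {{_ : NonZero m}} → Sign → Fin m → Fin m
signed Sign.+ x = x
signed Sign.- x = ⊖ x

-- vertices u_i (out i) and v_i (inn i)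
data Vertex (m : ℕ) : Set where
  out : Fin m → Vertex m
  inn : Fin m → Vertex m

data Adj {m} {{_ : NonZero m}} (R S T : Subset m) : Vertex m → Vertex m → Set where
  outer  : ∀ i j → j ∈ R → Adj R S T (out i) (out (i ⊕ j))
  outer' : ∀ i j → j ∈ R → Adj R S T (out (i ⊕ j)) (out i)
  inner  : ∀ i j → j ∈ T → Adj R S T (inn i) (inn (i ⊕ j))
  inner' : ∀ i j → j ∈ T → Adj R S T (inn (i ⊕ j)) (inn i)
  spoke  : ∀ i j → j ∈ S → Adj R S T (out i) (inn (i ⊕ j))
  spoke' : ∀ i j → j ∈ S → Adj R S T (inn (i ⊕ j)) (out i)

Connected : ∀ {m} {{_ : NonZero m}} (R S T : Subset m) → Set
Connected R S T = ∀ x y → Star (Adj R S T) x y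

SameComp : ∀ {m} {{_ : NonZero m}} (S : Subset m) → Vertex m → Vertex m → Set
SameComp S x y = Star (Adj ⊥ S ⊥) x y

gcdSet : (m : ℕ) → Subset m → ℕ
gcdSet m S = foldr gcd m (map toℕ (filter (λ x → x ∈? S) (allFin m)))

CongMod : ℕ → ℤ → ℤ → Set
CongMod d x y = (ℤ.+ d) ℤD.∣ (x ℤ.- y)

InIdx : (l μ ρ : ℕ) → ℕ × ℕ → Set
InIdx l μ ρ (i , j) = (i ≤ μ × j ≤ ρ) ⊎ (suc i ≤ μ × (suc ρ ≤ j × j ≤ l))

-- (λ,μ,ρ)-non-uniform representation of B(m; a, S, b)  (here l stands for λ).
-- The bijective labelling of the components of H(m;S) by the index set is
-- given as a vertex labelling L, constant exactly on components, onto the index set.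
record NonUniformRep {m} {{_ : NonZero m}} (a : Fin m) (S : Subset m) (b : Fin m)
                     (l μ ρ : ℕ) : Set where
  field
    l-pos   : 1 ≤ l
    μ-pos   : 1 ≤ μ
    ρ<l     : ρ < l
    params  : suc ρ * suc μ + (l ∸ ρ) * μ ≡ gcdSet m S
    ε       : Sign
    L       : Vertex m → ℕ × ℕ
    L-idx   : ∀ x → InIdx l μ ρ (L x)
    L-comp  : ∀ x y → SameComp S x y → L x ≡ L y
    L-sep   : ∀ x y → L x ≡ L y → SameComp S x y
    L-onto  : ∀ p → InIdx l μ ρ p → ∃ λ x → L x ≡ p
    L-u0    : L (out 0ₘ) ≡ (0 , 0)
    outer-step : ∀ i j x → ((suc i ≤ μ × suc j ≤ l) ⊎ (i ≡ μ × suc j ≤ ρ)) →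
                 L (out x) ≡ (i , j) → L (out (x ⊕ a)) ≡ (i , suc j)
    inner-step : ∀ i j x → ((suc (suc i) ≤ μ × j ≤ l) ⊎ (suc i ≡ μ × j ≤ ρ)) →
                 L (inn x) ≡ (i , j) → L (inn (x ⊕ signed ε b)) ≡ (suc i , j)

{-# OPTIONS --safe #-}
-- The components of H(m;S) are the residue classes modulo d = gcd(m,S): a spoke of type j ∈ S
-- preserves the residue, and conversely the translations of ℤ_m that keep every vertex in its
-- component are closed under sums and differences, so by Bézout they contain d. Numbering the
-- component of u_x and v_x by k = x·a⁻¹ mod d, an outer a-edge adds 1 to k and an inner εb-edge
-- adds εh, where b ≡ ha; choosing ε with εh ≡ h* = min(h, d − h) it adds h*. Writing 0, …, d − 1
-- in rows of length h*, i.e. labelling k by (k div h*, k mod h*), gives μ full rows and a last row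
-- of ρ + 1 cells: exactly the index set of a (h* − 1, μ, ρ)-representation. The last row is not
-- empty because h*, like h, is coprime to d, and μ ≥ 2 because 2h* ≤ d.
module Submission where

open import Defs
open import Data.Empty using (⊥-elim)
open import Data.Fin using (Fin; toℕ)
open import Data.Fin.Properties using (toℕ-fromℕ<; toℕ-injective; toℕ<n)
open import Data.Fin.Subset using (Subset; _∈_; ∣_∣; ⊥)
open import Data.Fin.Subset.Properties using (_∈?_; ∉⊥)
open import Data.Integer as ℤ using ()
open import Data.Integer.Properties using (m-n≡m⊖n; ∣⊖∣-≤; ∣m⊖n∣≡∣n⊖m∣; neg-involutive; pos-+; pos-*)
open import Data.List using ([]; _∷_; foldr; map; filter; allFin)
open import Data.List.Membership.Propositional using () renaming (_∈_ to _∈ₗ_)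
open import Data.List.Membership.Propositional.Properties using (∈-map⁺; ∈-map⁻; ∈-filter⁺; ∈-filter⁻; ∈-allFin)
open import Data.List.Relation.Unary.All as All using (All; []; _∷_)
open import Data.List.Relation.Unary.Any using (here; there)
open import Data.Nat
  using (ℕ; zero; suc; _+_; _*_; _∸_; _<_; _≤_; _⊓_; _%_; _/_; z≤n; s≤s; _≤?_; ∣_-_∣;
         NonZero; ≢-nonZero; ≢-nonZero⁻¹; >-nonZero⁻¹)
open import Data.Nat.Coprimality using (Coprime; coprime-Bézout)
open import Data.Nat.DivMod
open import Data.Nat.Divisibility
  using (_∣_; divides; ∣-refl; ∣-trans; n∣m*n; m∣m*n; ∣m+n∣m⇒∣n; 0∣⇒≡0; m%n≡0⇒n∣m; ∣n∣m%n⇒∣m; %-presˡ-∣)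
open import Data.Nat.GCD using (gcd; gcd[m,n]∣m; gcd[m,n]∣n; gcd-GCD; module Bézout)
open import Data.Nat.Properties
open import Algebra.Properties.CommutativeSemigroup *-commutativeSemigroup using (xy∙z≈xz∙y)
open import Data.Nat.Tactic.RingSolver using (solve-∀)
open import Data.Product using (_×_; _,_; ∃; proj₁; proj₂)
open import Data.Sign using (Sign)
open import Data.Sum using (_⊎_; inj₁; inj₂)
open import Function using (_∘_; _⇔_; mk⇔; Equivalence)
open import Level using (0ℓ)
open import Relation.Binary using (Setoid)
import Relation.Binary.Construct.On as On
open import Relation.Binary.Construct.Closure.ReflexiveTransitive using (ε; _◅_; _◅◅_; reverse)
open import Relation.Binary.PropositionalEquality
  using (_≡_; _≢_; refl; sym; trans; cong; cong₂; subst; module ≡-Reasoning)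
import Relation.Binary.PropositionalEquality as ≡
import Relation.Binary.Reasoning.Setoid as SetoidReasoning
open import Relation.Nullary using (¬_; yes; no)

open Equivalence using (to; from)

0%n≡0 : ∀ n .{{_ : NonZero n}} → 0 % n ≡ 0
0%n≡0 n = m*n%n≡0 0 n

∣+m-+n∣≡∣m-n∣ : ∀ m n → ℤ.∣ ℤ.+ m ℤ.- ℤ.+ n ∣ ≡ ∣ m - n ∣
∣+m-+n∣≡∣m-n∣ m n with ≤-total m n
... | inj₁ m≤n = begin
  ℤ.∣ ℤ.+ m ℤ.- ℤ.+ n ∣  ≡⟨ cong ℤ.∣_∣ (m-n≡m⊖n m n) ⟩
  ℤ.∣ m ℤ.⊖ n ∣          ≡⟨ ∣⊖∣-≤ m≤n ⟩
  n ∸ m                  ≡⟨ m≤n⇒∣m-n∣≡n∸m m≤n ⟨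
  ∣ m - n ∣              ∎
  where open ≡-Reasoning
... | inj₂ n≤m = begin
  ℤ.∣ ℤ.+ m ℤ.- ℤ.+ n ∣  ≡⟨ cong ℤ.∣_∣ (m-n≡m⊖n m n) ⟩
  ℤ.∣ m ℤ.⊖ n ∣          ≡⟨ ∣m⊖n∣≡∣n⊖m∣ m n ⟩
  ℤ.∣ n ℤ.⊖ m ∣          ≡⟨ ∣⊖∣-≤ n≤m ⟩
  m ∸ n                  ≡⟨ m≤n⇒∣n-m∣≡n∸m n≤m ⟨
  ∣ m - n ∣              ∎
  where open ≡-Reasoning

module Congruence (d : ℕ) .{{_ : NonZero d}} where

  infix 4 _≈_
  _≈_ : ℕ → ℕ → Set
  x ≈ y = x % d ≡ y % d

  ≈-setoid : Setoid 0ℓ 0ℓ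
  ≈-setoid = On.setoid (≡.setoid ℕ) (_% d)

  module ≈-Reasoning = SetoidReasoning ≈-setoid

  %-≈ : ∀ x → x % d ≈ x
  %-≈ x = m%n%n≡m%n x d

  d≈0 : d ≈ 0
  d≈0 = trans (n%n≡0 d) (sym (0%n≡0 d))

  +-cong : ∀ {x x′ y y′} → x ≈ x′ → y ≈ y′ → x + y ≈ x′ + y′
  +-cong {x} {x′} {y} {y′} x≈x′ y≈y′ = begin
    (x + y) % d            ≡⟨ %-distribˡ-+ x y d ⟩
    (x % d + y % d) % d    ≡⟨ cong₂ (λ u v → (u + v) % d) x≈x′ y≈y′ ⟩
    (x′ % d + y′ % d) % d  ≡⟨ %-distribˡ-+ x′ y′ d ⟨
    (x′ + y′) % d          ∎
    where open ≡-Reasoning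

  *-cong : ∀ {x x′ y y′} → x ≈ x′ → y ≈ y′ → x * y ≈ x′ * y′
  *-cong {x} {x′} {y} {y′} x≈x′ y≈y′ = begin
    (x * y) % d              ≡⟨ %-distribˡ-* x y d ⟩
    (x % d * (y % d)) % d    ≡⟨ cong₂ (λ u v → (u * v) % d) x≈x′ y≈y′ ⟩
    (x′ % d * (y′ % d)) % d  ≡⟨ %-distribˡ-* x′ y′ d ⟨
    (x′ * y′) % d            ∎
    where open ≡-Reasoning

  ≈⇒∣∸ : ∀ {x y} → x ≈ y → d ∣ x ∸ y
  ≈⇒∣∸ {x} {y} x≈y = divides (x / d ∸ y / d) (begin
    x ∸ y                                       ≡⟨ cong₂ _∸_ (m≡m%n+[m/n]*n x d) (m≡m%n+[m/n]*n y d) ⟩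
    (x % d + x / d * d) ∸ (y % d + y / d * d)   ≡⟨ cong (λ r → (r + x / d * d) ∸ (y % d + y / d * d)) x≈y ⟩
    (y % d + x / d * d) ∸ (y % d + y / d * d)   ≡⟨ [m+n]∸[m+o]≡n∸o (y % d) _ _ ⟩
    x / d * d ∸ y / d * d                       ≡⟨ *-distribʳ-∸ d (x / d) (y / d) ⟨
    (x / d ∸ y / d) * d                         ∎)
    where open ≡-Reasoning

  ∣∸⇒≈ : ∀ {x y} → y ≤ x → d ∣ x ∸ y → x ≈ y
  ∣∸⇒≈ {x} {y} y≤x d∣x∸y = trans (cong (_% d) (sym (m+[n∸m]≡n y≤x))) (%-remove-+ʳ y d∣x∸y)

  ∣⇒≈0 : ∀ {x} → d ∣ x → x ≈ 0
  ∣⇒≈0 = ∣∸⇒≈ z≤n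

  ≈⇔∣∣-∣ : ∀ {x y} → x ≈ y ⇔ d ∣ ∣ x - y ∣
  ≈⇔∣∣-∣ {x} {y} with ≤-total y x
  ... | inj₁ y≤x = mk⇔ (λ x≈y → subst (d ∣_) (sym (m≤n⇒∣n-m∣≡n∸m y≤x)) (≈⇒∣∸ x≈y))
                       (λ d∣ → ∣∸⇒≈ y≤x (subst (d ∣_) (m≤n⇒∣n-m∣≡n∸m y≤x) d∣))
  ... | inj₂ x≤y = mk⇔ (λ x≈y → subst (d ∣_) (sym (m≤n⇒∣m-n∣≡n∸m x≤y)) (≈⇒∣∸ (sym x≈y)))
                       (λ d∣ → sym (∣∸⇒≈ x≤y (subst (d ∣_) (m≤n⇒∣m-n∣≡n∸m x≤y) d∣)))

  +-cancelʳ-≈ : ∀ {x y} z → x + z ≈ y + z → x ≈ y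
  +-cancelʳ-≈ {x} {y} z x+z≈y+z = from ≈⇔∣∣-∣ (subst (d ∣_) ∣x+z-y+z∣≡∣x-y∣ (to ≈⇔∣∣-∣ x+z≈y+z))
    where
    ∣x+z-y+z∣≡∣x-y∣ : ∣ x + z - y + z ∣ ≡ ∣ x - y ∣
    ∣x+z-y+z∣≡∣x-y∣ = trans (cong₂ ∣_-_∣ (+-comm x z) (+-comm y z)) (∣m+n-m+o∣≡∣n-o∣ z x y)

  ∣-respˡ-≈ : ∀ {e x y} → e ∣ d → x ≈ y → e ∣ y → e ∣ x
  ∣-respˡ-≈ e∣d x≈y e∣y = ∣n∣m%n⇒∣m e∣d (subst (_ ∣_) (sym x≈y) (%-presˡ-∣ e∣y e∣d))

  inverse : ∀ {x} → Coprime x d → ∃ λ x′ → x * x′ ≈ 1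
  inverse {x} coprime with coprime-Bézout coprime
  ... | Bézout.+- u v 1+vd≡ux =
    u , trans (cong (_% d) (trans (*-comm x u) (sym 1+vd≡ux))) ([m+kn]%n≡m%n 1 v d)
  -- here x·u ≡ −1, so u·(d − 1) inverts x
  ... | Bézout.-+ u v 1+ux≡vd = u * e , +-cancelʳ-≈ e (begin
      x * (u * e) + e  ≡⟨ rearrange x u e ⟩
      (1 + u * x) * e  ≡⟨ cong (_* e) 1+ux≡vd ⟩
      v * d * e        ≈⟨ ∣⇒≈0 (divides (v * e) (xy∙z≈xz∙y v d e)) ⟩
      0                ≈⟨ d≈0 ⟨
      d                ≡⟨ m+[n∸m]≡n (>-nonZero⁻¹ d) ⟨
      1 + e            ∎)
    where
    open ≈-Reasoning
    e : ℕ
    e = d ∸ 1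
    rearrange : ∀ x u e → x * (u * e) + e ≡ (1 + u * x) * e
    rearrange = solve-∀

  cancel-inverse : ∀ {x x′} → x * x′ ≈ 1 → ∀ k → k * x * x′ ≈ k
  cancel-inverse {x} {x′} xx′≈1 k = begin
    k * x * x′    ≡⟨ *-assoc k x x′ ⟩
    k * (x * x′)  ≈⟨ *-cong {k} refl xx′≈1 ⟩
    k * 1         ≡⟨ *-identityʳ k ⟩
    k             ∎
    where open ≈-Reasoning

  congMod⇔≈ : ∀ {x y} → CongMod d (ℤ.+ x) (ℤ.+ y) ⇔ x ≈ y
  congMod⇔≈ {x} {y} = mk⇔ (λ c → from ≈⇔∣∣-∣ (subst (d ∣_) (∣+m-+n∣≡∣m-n∣ x y) c))
                          (λ x≈y → subst (d ∣_) (sym (∣+m-+n∣≡∣m-n∣ x y)) (to ≈⇔∣∣-∣ x≈y))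

  congMod-neg : ∀ {x y} → x + y ≈ 0 → CongMod d (ℤ.+ x) (ℤ.- ℤ.+ y)
  congMod-neg {x} {y} x+y≈0 = subst (λ z → d ∣ ℤ.∣ z ∣) x+y≡ (≈⇒∣∸ x+y≈0)
    where
    x+y≡ : ℤ.+ (x + y) ≡ ℤ.+ x ℤ.- ℤ.- ℤ.+ y
    x+y≡ = trans (pos-+ x y) (cong (ℤ._+_ (ℤ.+ x)) (sym (neg-involutive (ℤ.+ y))))

module GcdClosed (P : ℕ → Set)
  (+-closed : ∀ {t u} → P t → P u → P (t + u))
  (∸-closed : ∀ {t u} → P (t + u) → P u → P t) where

  *-closed : ∀ {t} → P t → ∀ k → P (k * t)
  *-closed pt zero    = ∸-closed pt pt
  *-closed pt (suc k) = +-closed pt (*-closed pt k)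

  gcd-closed : ∀ {t u} → P t → P u → P (gcd t u)
  gcd-closed {t} {u} pt pu with Bézout.identity (gcd-GCD t u)
  ... | Bézout.+- x y g+yu≡xt = ∸-closed (subst P (sym g+yu≡xt) (*-closed pt x)) (*-closed pu y)
  ... | Bézout.-+ x y g+xt≡yu = ∸-closed (subst P (sym g+xt≡yu) (*-closed pu y)) (*-closed pt x)

  foldr-gcd-closed : ∀ {t L} → P t → All P L → P (foldr gcd t L)
  foldr-gcd-closed pt []         = pt
  foldr-gcd-closed pt (ps ∷ pL) = gcd-closed ps (foldr-gcd-closed pt pL)

  gcdSet-closed : ∀ {m} (S : Subset m) → P m → (∀ {j} → j ∈ S → P (toℕ j)) → P (gcdSet m S)
  gcdSet-closed S pm pS = foldr-gcd-closed pm (All.tabulate p∈)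
    where
    p∈ : ∀ {t} → t ∈ₗ map toℕ (filter (_∈? S) (allFin _)) → P t
    p∈ t∈ with ∈-map⁻ toℕ t∈
    ... | j , j∈ , refl = pS (proj₂ (∈-filter⁻ (_∈? S) {xs = allFin _} j∈))

foldr-gcd∣ : ∀ t L → foldr gcd t L ∣ t
foldr-gcd∣ t []      = ∣-refl
foldr-gcd∣ t (s ∷ L) = ∣-trans (gcd[m,n]∣n s _) (foldr-gcd∣ t L)

foldr-gcd∣∈ : ∀ t {L s} → s ∈ₗ L → foldr gcd t L ∣ s
foldr-gcd∣∈ t {s ∷ L} (here refl) = gcd[m,n]∣m s (foldr gcd t L)
foldr-gcd∣∈ t {s′ ∷ L} (there s∈L) = ∣-trans (gcd[m,n]∣n s′ (foldr gcd t L)) (foldr-gcd∣∈ t s∈L)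

gcdSet∣m : ∀ m S → gcdSet m S ∣ m
gcdSet∣m m S = foldr-gcd∣ m (map toℕ (filter (_∈? S) (allFin m)))

gcdSet∣S : ∀ m S {j} → j ∈ S → gcdSet m S ∣ toℕ j
gcdSet∣S m S j∈S = foldr-gcd∣∈ m (∈-map⁺ toℕ (∈-filter⁺ (_∈? S) (∈-allFin _) j∈S))

gcdSet-nonZero : ∀ m .{{_ : NonZero m}} S → NonZero (gcdSet m S)
gcdSet-nonZero m S = ≢-nonZero (λ d≡0 → ≢-nonZero⁻¹ m (0∣⇒≡0 (subst (_∣ m) d≡0 (gcdSet∣m m S))))

module _ {m : ℕ} {{_ : NonZero m}} where

  open Congruence m using (+-cong; %-≈)

  toℕ-mod : ∀ n → toℕ (n mod m) ≡ n % m
  toℕ-mod n = toℕ-fromℕ< (m%n<n n m)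

  toℕ-0ₘ : toℕ (0ₘ {m}) ≡ 0
  toℕ-0ₘ = trans (toℕ-mod 0) (0%n≡0 m)

  infixl 6 _⊕ℕ_
  _⊕ℕ_ : Fin m → ℕ → Fin m
  x ⊕ℕ t = (toℕ x + t) mod m

  toℕ%m : ∀ (x : Fin m) → toℕ x % m ≡ toℕ x
  toℕ%m x = m<n⇒m%n≡m (toℕ<n x)

  mod-≡ : ∀ n (y : Fin m) → n % m ≡ toℕ y → n mod m ≡ y
  mod-≡ n y n%m≡y = toℕ-injective (trans (toℕ-mod n) n%m≡y)

  ⊕-0ₘ : ∀ x → x ⊕ 0ₘ ≡ x
  ⊕-0ₘ x = mod-≡ _ x (begin
    (toℕ x + toℕ 0ₘ) % m  ≡⟨ cong (λ z → (toℕ x + z) % m) toℕ-0ₘ ⟩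
    (toℕ x + 0) % m       ≡⟨ cong (_% m) (+-identityʳ (toℕ x)) ⟩
    toℕ x % m             ≡⟨ toℕ%m x ⟩
    toℕ x                 ∎)
    where open ≡-Reasoning

  ⊕ℕ-assoc : ∀ x t u → x ⊕ℕ t ⊕ℕ u ≡ x ⊕ℕ (t + u)
  ⊕ℕ-assoc x t u = toℕ-injective (begin
    toℕ (x ⊕ℕ t ⊕ℕ u)        ≡⟨ toℕ-mod _ ⟩
    (toℕ (x ⊕ℕ t) + u) % m   ≡⟨ +-cong (trans (cong (_% m) (toℕ-mod _)) (%-≈ _)) refl ⟩
    (toℕ x + t + u) % m      ≡⟨ cong (_% m) (+-assoc (toℕ x) t u) ⟩
    (toℕ x + (t + u)) % m    ≡⟨ toℕ-mod _ ⟨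
    toℕ (x ⊕ℕ (t + u))       ∎)
    where open ≡-Reasoning

  ⊕ℕ-m : ∀ x → x ⊕ℕ m ≡ x
  ⊕ℕ-m x = mod-≡ _ x (trans ([m+n]%n≡m%n (toℕ x) m) (toℕ%m x))

  ⊕ℕ-∸ : ∀ {x y : Fin m} → toℕ x ≤ toℕ y → x ⊕ℕ (toℕ y ∸ toℕ x) ≡ y
  ⊕ℕ-∸ {x} {y} x≤y = mod-≡ _ y (trans (cong (_% m) (m+[n∸m]≡n x≤y)) (toℕ%m y))

Adj-sym : ∀ {m} {{_ : NonZero m}} {R S T : Subset m} {v w} → Adj R S T v w → Adj R S T w v
Adj-sym (outer i j j∈R)  = outer' i j j∈R
Adj-sym (outer' i j j∈R) = outer i j j∈R
Adj-sym (inner i j j∈T)  = inner' i j j∈T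
Adj-sym (inner' i j j∈T) = inner i j j∈T
Adj-sym (spoke i j j∈S)  = spoke' i j j∈S
Adj-sym (spoke' i j j∈S) = spoke i j j∈S

SameComp-sym : ∀ {m} {{_ : NonZero m}} {S : Subset m} {v w} → SameComp S v w → SameComp S w v
SameComp-sym = reverse Adj-sym

index : ∀ {m} → Vertex m → Fin m
index (out x) = x
index (inn x) = x

record Coordinates {m} {{_ : NonZero m}} (a : Fin m) (S : Subset m) (b : Fin m) (σ : Sign)
                   (n step : ℕ) : Set where
  field
    κ       : Vertex m → ℕ
    κ<n     : ∀ v → κ v < n
    κ-comp  : ∀ v w → SameComp S v w → κ v ≡ κ w
    κ-sep   : ∀ v w → κ v ≡ κ w → SameComp S v w
    κ-onto  : ∀ k → k < n → ∃ λ x → κ (out x) ≡ k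
    κ-u₀    : κ (out 0ₘ) ≡ 0
    κ-outer : ∀ x → κ (out x) + 1 < n → κ (out (x ⊕ a)) ≡ κ (out x) + 1
    κ-inner : ∀ x → κ (inn x) + step < n → κ (inn (x ⊕ signed σ b)) ≡ κ (inn x) + step

module Components {m : ℕ} {{_ : NonZero m}} (S : Subset m) (0∈S : 0ₘ ∈ S) where

  instance
    d-nonZero : NonZero (gcdSet m S)
    d-nonZero = gcdSet-nonZero m S

  open Congruence (gcdSet m S) public

  toℕ-mod≈ : ∀ n → toℕ (n mod m) ≈ n
  toℕ-mod≈ n = trans (cong (_% gcdSet m S) (toℕ-mod n)) (m∣n⇒o%n%m≡o%m _ m n (gcdSet∣m m S))

  spoke₀ : ∀ x → SameComp S (out x) (inn x)
  spoke₀ x = subst (λ y → SameComp S (out x) (inn y)) (⊕-0ₘ x) (spoke x 0ₘ 0∈S ◅ ε)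

  Period : ℕ → Set
  Period t = ∀ x → SameComp S (out x) (out (x ⊕ℕ t))

  period-+ : ∀ {t u} → Period t → Period u → Period (t + u)
  period-+ {t} {u} pt pu x = pt x ◅◅ subst (SameComp S _ ∘ out) (⊕ℕ-assoc x t u) (pu (x ⊕ℕ t))

  period-∸ : ∀ {t u} → Period (t + u) → Period u → Period t
  period-∸ {t} {u} ptu pu x =
    ptu x ◅◅ SameComp-sym (subst (SameComp S _ ∘ out) (⊕ℕ-assoc x t u) (pu (x ⊕ℕ t)))

  period-m : Period m
  period-m x = subst (SameComp S (out x) ∘ out) (sym (⊕ℕ-m x)) ε

  period-S : ∀ {j} → j ∈ S → Period (toℕ j)
  period-S {j} j∈S x = spoke x j j∈S ◅ SameComp-sym (spoke₀ (x ⊕ j))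

  period-∣ : ∀ {t} → gcdSet m S ∣ t → Period t
  period-∣ (divides k refl) = *-closed (gcdSet-closed S period-m period-S) k
    where open GcdClosed Period period-+ period-∸

  ≈⇒SameComp-out : ∀ x y → toℕ x ≈ toℕ y → SameComp S (out x) (out y)
  ≈⇒SameComp-out x y x≈y with ≤-total (toℕ x) (toℕ y)
  ... | inj₁ x≤y = subst (SameComp S (out x) ∘ out) (⊕ℕ-∸ x≤y) (period-∣ (≈⇒∣∸ (sym x≈y)) x)
  ... | inj₂ y≤x = SameComp-sym (subst (SameComp S (out y) ∘ out) (⊕ℕ-∸ y≤x) (period-∣ (≈⇒∣∸ x≈y) y))

  to-out : ∀ v → SameComp S v (out (index v))
  to-out (out x) = ε
  to-out (inn x) = SameComp-sym (spoke₀ x)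

  spoke-≈ : ∀ i {j} → j ∈ S → toℕ (i ⊕ j) ≈ toℕ i
  spoke-≈ i {j} j∈S = begin
    toℕ (i ⊕ j)      ≈⟨ toℕ-mod≈ _ ⟩
    toℕ i + toℕ j    ≈⟨ +-cong {toℕ i} refl (∣⇒≈0 (gcdSet∣S m S j∈S)) ⟩
    toℕ i + 0        ≡⟨ +-identityʳ (toℕ i) ⟩
    toℕ i            ∎
    where open ≈-Reasoning

  Adj⇒≈ : ∀ {v w} → Adj ⊥ S ⊥ v w → toℕ (index v) ≈ toℕ (index w)
  Adj⇒≈ (outer _ _ j∈⊥)  = ⊥-elim (∉⊥ j∈⊥)
  Adj⇒≈ (outer' _ _ j∈⊥) = ⊥-elim (∉⊥ j∈⊥)
  Adj⇒≈ (inner _ _ j∈⊥)  = ⊥-elim (∉⊥ j∈⊥)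
  Adj⇒≈ (inner' _ _ j∈⊥) = ⊥-elim (∉⊥ j∈⊥)
  Adj⇒≈ (spoke i _ j∈S)  = sym (spoke-≈ i j∈S)
  Adj⇒≈ (spoke' i _ j∈S) = spoke-≈ i j∈S

  SameComp⇔≈ : ∀ {v w} → SameComp S v w ⇔ toℕ (index v) ≈ toℕ (index w)
  SameComp⇔≈ {v} {w} = mk⇔ SameComp⇒≈
    (λ v≈w → to-out v ◅◅ ≈⇒SameComp-out _ _ v≈w ◅◅ SameComp-sym (to-out w))
    where
    SameComp⇒≈ : ∀ {v w} → SameComp S v w → toℕ (index v) ≈ toℕ (index w)
    SameComp⇒≈ ε       = refl
    SameComp⇒≈ (e ◅ p) = trans (Adj⇒≈ e) (SameComp⇒≈ p)

  module _ {a : Fin m} {a′ : ℕ} (aa′≈1 : toℕ a * a′ ≈ 1) where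

    coord : Fin m → ℕ
    coord x = toℕ x * a′ % gcdSet m S

    coord-0ₘ : coord 0ₘ ≡ 0
    coord-0ₘ = trans (cong (λ z → z * a′ % gcdSet m S) toℕ-0ₘ) (0%n≡0 (gcdSet m S))

    coord-injective : ∀ {x y} → coord x ≡ coord y → toℕ x ≈ toℕ y
    coord-injective {x} {y} xa′≈ya′ = begin
      toℕ x                  ≈⟨ cancel-inverse aa′≈1 (toℕ x) ⟨
      toℕ x * toℕ a * a′     ≡⟨ xy∙z≈xz∙y (toℕ x) (toℕ a) a′ ⟩
      toℕ x * a′ * toℕ a     ≈⟨ *-cong xa′≈ya′ refl ⟩
      toℕ y * a′ * toℕ a     ≡⟨ xy∙z≈xz∙y (toℕ y) a′ (toℕ a) ⟩
      toℕ y * toℕ a * a′     ≈⟨ cancel-inverse aa′≈1 (toℕ y) ⟩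
      toℕ y                  ∎
      where open ≈-Reasoning

    coord-surjective : ∀ k → k < gcdSet m S → coord ((k * toℕ a) mod m) ≡ k
    coord-surjective k k<d = trans kaa′≈k (m<n⇒m%n≡m k<d)
      where
      kaa′≈k : toℕ ((k * toℕ a) mod m) * a′ ≈ k
      kaa′≈k = trans (*-cong (toℕ-mod≈ _) refl) (cancel-inverse aa′≈1 k)

    coord-⊕ : ∀ x c {δ} → toℕ c * a′ ≈ δ → coord x + δ < gcdSet m S → coord (x ⊕ c) ≡ coord x + δ
    coord-⊕ x c {δ} ca′≈δ bound = trans shifted (m<n⇒m%n≡m bound)
      where
      shifted : toℕ (x ⊕ c) * a′ ≈ coord x + δ
      shifted = begin
        toℕ (x ⊕ c) * a′          ≈⟨ *-cong (toℕ-mod≈ _) refl ⟩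
        (toℕ x + toℕ c) * a′      ≡⟨ *-distribʳ-+ a′ (toℕ x) (toℕ c) ⟩
        toℕ x * a′ + toℕ c * a′   ≈⟨ +-cong (sym (%-≈ (toℕ x * a′))) ca′≈δ ⟩
        coord x + δ               ∎
        where open ≈-Reasoning

    coordinates : ∀ {b : Fin m} {step} σ → toℕ (signed σ b) * a′ ≈ step →
                  Coordinates a S b σ (gcdSet m S) step
    coordinates σ ba′≈step = record
      { κ       = coord ∘ index
      ; κ<n     = λ v → m%n<n _ (gcdSet m S)
      ; κ-comp  = λ v w v~w → *-cong (to SameComp⇔≈ v~w) refl
      ; κ-sep   = λ v w κv≡κw → from SameComp⇔≈ (coord-injective κv≡κw)
      ; κ-onto  = λ k k<d → (k * toℕ a) mod m , coord-surjective k k<d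
      ; κ-u₀    = coord-0ₘ
      ; κ-outer = λ x → coord-⊕ x a aa′≈1
      ; κ-inner = λ x → coord-⊕ x (signed σ _) ba′≈step
      }

module Grid (l μ ρ : ℕ) (ρ<l : ρ < l) where

  D : ℕ
  D = μ * suc l + suc ρ

  cell : ℕ → ℕ × ℕ
  cell k = k / suc l , k % suc l

  cell-+* : ∀ i {j} → j ≤ l → cell (j + i * suc l) ≡ (i , j)
  cell-+* i {j} j≤l = cong₂ _,_ quotient remainder
    where
    quotient : (j + i * suc l) / suc l ≡ i
    quotient = begin
      (j + i * suc l) / suc l          ≡⟨ +-distrib-/-∣ʳ j (n∣m*n i) ⟩
      j / suc l + i * suc l / suc l    ≡⟨ cong₂ _+_ (m<n⇒m/n≡0 (s≤s j≤l)) (m*n/n≡m i (suc l)) ⟩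
      i                                ∎
      where open ≡-Reasoning
    remainder : (j + i * suc l) % suc l ≡ j
    remainder = trans ([m+kn]%n≡m%n j i (suc l)) (m<n⇒m%n≡m (s≤s j≤l))

  cell⁻¹ : ∀ k {i j} → cell k ≡ (i , j) → k ≡ j + i * suc l
  cell⁻¹ k refl = m≡m%n+[m/n]*n k (suc l)

  cell-injective : ∀ {k k′} → cell k ≡ cell k′ → k ≡ k′
  cell-injective {k} {k′} eq = trans (cell⁻¹ k eq) (sym (cell⁻¹ k′ refl))

  InGrid : ℕ × ℕ → Set
  InGrid (i , j) = j ≤ l × j + i * suc l < D

  InIdx⇒InGrid : ∀ {p} → InIdx l μ ρ p → InGrid p
  InIdx⇒InGrid {i , j} (inj₁ (i≤μ , j≤ρ)) = ≤-trans j≤ρ (<⇒≤ ρ<l) , (begin-strict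
    j + i * suc l      ≤⟨ +-mono-≤ j≤ρ (*-monoˡ-≤ (suc l) i≤μ) ⟩
    ρ + μ * suc l      <⟨ n<1+n _ ⟩
    suc ρ + μ * suc l  ≡⟨ +-comm (suc ρ) _ ⟩
    D                  ∎)
    where open ≤-Reasoning
  InIdx⇒InGrid {i , j} (inj₂ (i<μ , _ , j≤l)) = j≤l , (begin-strict
    j + i * suc l      <⟨ +-monoˡ-< (i * suc l) (s≤s j≤l) ⟩
    suc i * suc l      ≤⟨ *-monoˡ-≤ (suc l) i<μ ⟩
    μ * suc l          ≤⟨ m≤m+n _ _ ⟩
    D                  ∎)
    where open ≤-Reasoning

  InGrid⇒InIdx : ∀ {p} → InGrid p → InIdx l μ ρ p
  InGrid⇒InIdx {i , j} (j≤l , k<D) with j ≤? ρ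
  ... | yes j≤ρ = inj₁ (≤-pred (*-cancelʳ-< (suc l) i (suc μ) (begin-strict
    i * suc l          ≤⟨ m≤n+m _ j ⟩
    j + i * suc l      <⟨ k<D ⟩
    μ * suc l + suc ρ  ≤⟨ +-monoʳ-≤ (μ * suc l) (s≤s (<⇒≤ ρ<l)) ⟩
    μ * suc l + suc l  ≡⟨ +-comm _ (suc l) ⟩
    suc μ * suc l      ∎)) , j≤ρ)
    where open ≤-Reasoning
  ... | no j≰ρ = inj₂ (*-cancelʳ-< (suc l) i μ (+-cancelʳ-< (suc ρ) _ _ (begin-strict
    i * suc l + suc ρ  ≤⟨ +-monoʳ-≤ (i * suc l) (≰⇒> j≰ρ) ⟩
    i * suc l + j      ≡⟨ +-comm _ j ⟩
    j + i * suc l      <⟨ k<D ⟩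
    D                  ∎)) , ≰⇒> j≰ρ , j≤l)
    where open ≤-Reasoning

  cell-InIdx : ∀ {k} → k < D → InIdx l μ ρ (cell k)
  cell-InIdx {k} k<D = InGrid⇒InIdx (≤-pred (m%n<n k (suc l)) , subst (_< D) (cell⁻¹ k refl) k<D)

  outer-InIdx : ∀ {i j} → (suc i ≤ μ × suc j ≤ l) ⊎ (i ≡ μ × suc j ≤ ρ) → InIdx l μ ρ (i , suc j)
  outer-InIdx {j = j} (inj₁ (i<μ , j<l)) with suc j ≤? ρ
  ... | yes j<ρ = inj₁ (<⇒≤ i<μ , j<ρ)
  ... | no j≮ρ  = inj₂ (i<μ , ≰⇒> j≮ρ , j<l)
  outer-InIdx (inj₂ (i≡μ , j<ρ)) = inj₁ (≤-reflexive i≡μ , j<ρ)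

  inner-InIdx : ∀ {i j} → (suc (suc i) ≤ μ × j ≤ l) ⊎ (suc i ≡ μ × j ≤ ρ) → InIdx l μ ρ (suc i , j)
  inner-InIdx {j = j} (inj₁ (i+1<μ , j≤l)) with j ≤? ρ
  ... | yes j≤ρ = inj₁ (<⇒≤ i+1<μ , j≤ρ)
  ... | no j≰ρ  = inj₂ (i+1<μ , ≰⇒> j≰ρ , j≤l)
  inner-InIdx (inj₂ (i+1≡μ , j≤ρ)) = inj₁ (≤-reflexive i+1≡μ , j≤ρ)

grid-size : ∀ {l} μ ρ → ρ ≤ l → suc ρ * suc μ + (l ∸ ρ) * μ ≡ μ * suc l + suc ρ
grid-size {l} μ ρ ρ≤l = trans (expand μ ρ (l ∸ ρ)) (cong (λ t → μ * suc t + suc ρ) (m+[n∸m]≡n ρ≤l))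
  where
  expand : ∀ μ ρ t → suc ρ * suc μ + t * μ ≡ μ * suc (ρ + t) + suc ρ
  expand = solve-∀

nonUniformRep : ∀ {m} {{_ : NonZero m}} {a : Fin m} {S b σ l μ ρ} → ρ < l → 1 ≤ μ →
                gcdSet m S ≡ μ * suc l + suc ρ →
                Coordinates a S b σ (μ * suc l + suc ρ) (suc l) → NonUniformRep a S b l μ ρ
nonUniformRep {a = a} {b = b} {σ} {l} {μ} {ρ} ρ<l 1≤μ d≡D C = record
  { l-pos      = ≤-trans (s≤s z≤n) ρ<l
  ; μ-pos      = 1≤μ
  ; ρ<l        = ρ<l
  ; params     = trans (grid-size μ ρ (<⇒≤ ρ<l)) (sym d≡D)
  ; ε          = σ
  ; L          = cell ∘ κ
  ; L-idx      = λ v → cell-InIdx (κ<n v)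
  ; L-comp     = λ v w v~w → cong cell (κ-comp v w v~w)
  ; L-sep      = λ v w Lv≡Lw → κ-sep v w (cell-injective Lv≡Lw)
  ; L-onto     = onto
  ; L-u0       = trans (cong cell κ-u₀) (cell-+* 0 z≤n)
  ; outer-step = outer-step
  ; inner-step = inner-step
  }
  where
  open Grid l μ ρ ρ<l
  open Coordinates C

  onto : ∀ p → InIdx l μ ρ p → ∃ λ x → cell (κ x) ≡ p
  onto (i , j) p∈ with InIdx⇒InGrid p∈
  ... | j≤l , k<D with κ-onto _ k<D
  ...   | x , κx≡k = out x , trans (cong cell κx≡k) (cell-+* i j≤l)

  outer-step : ∀ i j x → (suc i ≤ μ × suc j ≤ l) ⊎ (i ≡ μ × suc j ≤ ρ) →
               cell (κ (out x)) ≡ (i , j) → cell (κ (out (x ⊕ a))) ≡ (i , suc j)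
  outer-step i j x cond Lx≡ with InIdx⇒InGrid (outer-InIdx cond)
  ... | j<l , k<D = begin
    cell (κ (out (x ⊕ a)))    ≡⟨ cong cell (κ-outer x (subst (_< D) (sym κ+1≡) k<D)) ⟩
    cell (κ (out x) + 1)      ≡⟨ cong cell κ+1≡ ⟩
    cell (suc j + i * suc l)  ≡⟨ cell-+* i j<l ⟩
    (i , suc j)               ∎
    where
    open ≡-Reasoning
    κ+1≡ : κ (out x) + 1 ≡ suc j + i * suc l
    κ+1≡ = trans (+-comm _ 1) (cong suc (cell⁻¹ _ Lx≡))

  inner-step : ∀ i j x → (suc (suc i) ≤ μ × j ≤ l) ⊎ (suc i ≡ μ × j ≤ ρ) →
               cell (κ (inn x)) ≡ (i , j) → cell (κ (inn (x ⊕ signed σ b))) ≡ (suc i , j)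
  inner-step i j x cond Lx≡ with InIdx⇒InGrid (inner-InIdx cond)
  ... | j≤l , k<D = begin
    cell (κ (inn (x ⊕ signed σ b)))  ≡⟨ cong cell (κ-inner x (subst (_< D) (sym κ+s≡) k<D)) ⟩
    cell (κ (inn x) + suc l)         ≡⟨ cong cell κ+s≡ ⟩
    cell (j + suc i * suc l)         ≡⟨ cell-+* (suc i) j≤l ⟩
    (suc i , j)                      ∎
    where
    open ≡-Reasoning
    κ+s≡ : κ (inn x) + suc l ≡ j + suc i * suc l
    κ+s≡ = begin
      κ (inn x) + suc l          ≡⟨ cong (_+ suc l) (cell⁻¹ _ Lx≡) ⟩
      j + i * suc l + suc l      ≡⟨ +-assoc j _ _ ⟩
      j + (i * suc l + suc l)    ≡⟨ cong (j +_) (+-comm (i * suc l) (suc l)) ⟩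
      j + suc i * suc l          ∎

nonzero-remainder : ∀ d s .{{_ : NonZero s}} → ¬ s ∣ d → ∃ λ μ → ∃ λ ρ → d ≡ μ * s + suc ρ × suc ρ < s
nonzero-remainder d s s∤d with d % s in d%s≡
... | zero  = ⊥-elim (s∤d (m%n≡0⇒n∣m d s d%s≡))
... | suc ρ = d / s , ρ , d≡ , subst (_< s) d%s≡ (m%n<n d s)
  where
  d≡ : d ≡ d / s * s + suc ρ
  d≡ = trans (m≡m%n+[m/n]*n d s) (trans (cong (_+ d / s * s) d%s≡) (+-comm (suc ρ) _))

quotient>1 : ∀ {d s μ ρ} → d ≡ μ * s + suc ρ → suc ρ < s → s + s ≤ d → 1 < μ
quotient>1 {d} {s} {μ} {ρ} d≡ ρ<s 2s≤d = *-cancelʳ-< s 1 μ (+-cancelʳ-< s _ _ (begin-strict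
  1 * s + s        ≡⟨ cong (_+ s) (*-identityˡ s) ⟩
  s + s            ≤⟨ 2s≤d ⟩
  d                ≡⟨ d≡ ⟩
  μ * s + suc ρ    <⟨ +-monoʳ-< (μ * s) ρ<s ⟩
  μ * s + s        ∎))
  where open ≤-Reasoning

quotient<dividend : ∀ {d s μ ρ} .{{_ : NonZero s}} → d ≡ μ * s + suc ρ → μ < d
quotient<dividend {d} {s} {μ} {ρ} d≡ = begin-strict
  μ              ≤⟨ m≤m*n μ s ⟩
  μ * s          <⟨ m<m+n (μ * s) (s≤s z≤n) ⟩
  μ * s + suc ρ  ≡⟨ d≡ ⟨
  d              ∎
  where open ≤-Reasoning

representation-from-coordinates : ∀ {m} {{_ : NonZero m}} {a : Fin m} {S b σ} s → 2 ≤ s →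
  ¬ s ∣ gcdSet m S → s + s ≤ gcdSet m S → Coordinates a S b σ (gcdSet m S) s →
  ∃ λ μ → ∃ λ ρ → gcdSet m S ≡ μ * s + suc ρ × suc ρ < s ×
    1 ≤ s ∸ 1 × 1 < μ × μ < gcdSet m S × ρ < s ∸ 1 × NonUniformRep a S b (s ∸ 1) μ ρ
representation-from-coordinates {a = a} {S} {b} {σ} (suc l) (s≤s 1≤l) s∤d 2s≤d C
  with nonzero-remainder _ (suc l) s∤d
... | μ , ρ , d≡ , ρ<s = μ , ρ , d≡ , ρ<s , 1≤l , 1<μ , quotient<dividend d≡ , ≤-pred ρ<s ,
      nonUniformRep (≤-pred ρ<s) (<⇒≤ 1<μ) d≡ (subst (λ n → Coordinates a S b σ n (suc l)) d≡ C)
  where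
  1<μ : 1 < μ
  1<μ = quotient>1 d≡ ρ<s 2s≤d

module UnitSteps {m} {{_ : NonZero m}} {a : Fin m} {S : Subset m} {b : Fin m} (0∈S : 0ₘ ∈ S)
  (1<d : 1 < gcdSet m S) (coprime-a : Coprime (toℕ a) (gcdSet m S))
  (coprime-b : Coprime (toℕ b) (gcdSet m S)) where

  open Components S 0∈S

  private
    d A B : ℕ
    d = gcdSet m S
    A = toℕ a
    B = toℕ b

  a′ : ℕ
  a′ = proj₁ (inverse coprime-a)

  aa′≈1 : A * a′ ≈ 1
  aa′≈1 = proj₂ (inverse coprime-a)

  congMod-*⇔≈ : ∀ h → CongMod d (ℤ.+ B) (ℤ.+ h ℤ.* ℤ.+ A) ⇔ B ≈ h * A
  congMod-*⇔≈ h = subst (λ z → CongMod d (ℤ.+ B) z ⇔ B ≈ h * A) (pos-* h A) congMod⇔≈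

  h₀ : ℕ
  h₀ = B * a′ % d

  B≈h₀A : B ≈ h₀ * A
  B≈h₀A = begin
    B              ≈⟨ cancel-inverse aa′≈1 B ⟨
    B * A * a′     ≡⟨ xy∙z≈xz∙y B A a′ ⟩
    B * a′ * A     ≈⟨ *-cong (%-≈ (B * a′)) refl ⟨
    h₀ * A         ∎
    where open ≈-Reasoning

  solution : ¬ CongMod d (ℤ.+ B) (ℤ.+ A) → ¬ CongMod d (ℤ.+ B) (ℤ.- (ℤ.+ A)) →
             ∃ λ h → 1 < h × h < d ∸ 1 × CongMod d (ℤ.+ B) (ℤ.+ h ℤ.* ℤ.+ A)
  solution b≢a b≢-a = h₀ , ≤∧≢⇒< (n≢0⇒n>0 h₀≢0) (h₀≢1 ∘ sym) , ≤∧≢⇒< (<⇒≤pred (m%n<n _ d)) h₀≢d∸1 ,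
                      from (congMod-*⇔≈ h₀) B≈h₀A
    where
    h₀≢0 : h₀ ≢ 0
    h₀≢0 h₀≡0 = <⇒≢ 1<d (sym (coprime-b (≈⇒∣∸ (trans B≈h₀A (cong (λ t → t * A % d) h₀≡0)) , ∣-refl)))
    h₀≢1 : h₀ ≢ 1
    h₀≢1 h₀≡1 = b≢a (from congMod⇔≈ (trans B≈h₀A (cong (_% d) (trans (cong (_* A) h₀≡1) (*-identityˡ A)))))
    h₀≢d∸1 : h₀ ≢ d ∸ 1
    h₀≢d∸1 h₀≡d∸1 = b≢-a (congMod-neg {B} {A} (begin
      B + A            ≈⟨ +-cong B≈h₀A refl ⟩
      h₀ * A + A       ≡⟨ cong (λ t → t * A + A) h₀≡d∸1 ⟩
      (d ∸ 1) * A + A  ≡⟨ +-comm _ A ⟩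
      suc (d ∸ 1) * A  ≡⟨ cong (_* A) (suc-pred d) ⟩
      d * A            ≈⟨ *-cong d≈0 refl ⟩
      0                ∎))
      where open ≈-Reasoning

  module Solution (h : ℕ) (1<h : 1 < h) (h<d∸1 : h < d ∸ 1) (B≈hA : B ≈ h * A) where

    hs : ℕ
    hs = h ⊓ (d ∸ h)

    2+h≤d : 2 + h ≤ d
    2+h≤d = subst (_≤ d) (+-comm (suc h) 1) (m≤o∸n⇒m+n≤o (suc h) (<⇒≤ 1<d) h<d∸1)

    h≤d : h ≤ d
    h≤d = ≤-trans (m≤n+m h 2) 2+h≤d

    2≤hs : 2 ≤ hs
    2≤hs = ⊓-glb 1<h (subst (_≤ d ∸ h) (m+n∸n≡m 2 h) (∸-monoˡ-≤ h 2+h≤d))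

    hs+hs≤d : hs + hs ≤ d
    hs+hs≤d = ≤-trans (+-mono-≤ (m⊓n≤m h (d ∸ h)) (m⊓n≤n h (d ∸ h))) (≤-reflexive (m+[n∸m]≡n h≤d))

    coprime-h : Coprime h d
    coprime-h (e∣h , e∣d) = coprime-b (∣-respˡ-≈ e∣d B≈hA (∣-trans e∣h (m∣m*n A)) , e∣d)

    hs∤d : ¬ hs ∣ d
    hs∤d hs∣d = <⇒≢ 2≤hs (sym (coprime-h (hs∣h , hs∣d)))
      where
      hs∣h : hs ∣ h
      hs∣h with ⊓-sel h (d ∸ h)
      ... | inj₁ hs≡h   = subst (hs ∣_) hs≡h ∣-refl
      ... | inj₂ hs≡d∸h = ∣m+n∣m⇒∣n (subst (hs ∣_) (sym (m∸n+n≡m h≤d)) hs∣d) (subst (hs ∣_) hs≡d∸h ∣-refl)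

    ba′≈h : B * a′ ≈ h
    ba′≈h = trans (*-cong B≈hA refl) (cancel-inverse aa′≈1 h)

    ⊖ba′≈d∸h : toℕ (⊖ b) * a′ ≈ d ∸ h
    ⊖ba′≈d∸h = +-cancelʳ-≈ h (begin
      toℕ (⊖ b) * a′ + h       ≈⟨ +-cong (*-cong (toℕ-mod≈ (m ∸ B)) refl) (sym ba′≈h) ⟩
      (m ∸ B) * a′ + B * a′    ≡⟨ *-distribʳ-+ a′ (m ∸ B) B ⟨
      (m ∸ B + B) * a′         ≡⟨ cong (_* a′) (m∸n+n≡m (<⇒≤ (toℕ<n b))) ⟩
      m * a′                   ≈⟨ ∣⇒≈0 (∣-trans (gcdSet∣m m S) (m∣m*n a′)) ⟩
      0                        ≈⟨ d≈0 ⟨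
      d                        ≡⟨ m∸n+n≡m h≤d ⟨
      d ∸ h + h                ∎)
      where open ≈-Reasoning

    step-sign : ∃ λ σ → toℕ (signed σ b) * a′ ≈ hs
    step-sign with ⊓-sel h (d ∸ h)
    ... | inj₁ hs≡h   = Sign.+ , trans ba′≈h (cong (_% d) (sym hs≡h))
    ... | inj₂ hs≡d∸h = Sign.- , trans ⊖ba′≈d∸h (cong (_% d) (sym hs≡d∸h))

  representation : ∀ h → 1 < h → h < d ∸ 1 → CongMod d (ℤ.+ B) (ℤ.+ h ℤ.* ℤ.+ A) →
    let hs = h ⊓ (d ∸ h) in
    ∃ λ μ → ∃ λ ρ → d ≡ μ * hs + suc ρ × suc ρ < hs ×
      1 ≤ hs ∸ 1 × 1 < μ × μ < d × ρ < hs ∸ 1 × NonUniformRep a S b (hs ∸ 1) μ ρ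
  representation h 1<h h<d∸1 congMod = representation-from-coordinates hs 2≤hs hs∤d hs+hs≤d
    (coordinates aa′≈1 (proj₁ step-sign) (proj₂ step-sign))
    where open Solution h 1<h h<d∸1 (to (congMod-*⇔≈ h) congMod)

  some-representation : (∃ λ h → 1 < h × h < d ∸ 1 × CongMod d (ℤ.+ B) (ℤ.+ h ℤ.* ℤ.+ A)) →
    ∃ λ l → ∃ λ μ → ∃ λ ρ → 1 ≤ l × 1 < μ × μ < d × ρ < l × NonUniformRep a S b l μ ρ
  some-representation (h , 1<h , h<d∸1 , congMod) with representation h 1<h h<d∸1 congMod
  ... | μ , ρ , _ , _ , 1≤l , 1<μ , μ<d , ρ<l , R = _ , μ , ρ , 1≤l , 1<μ , μ<d , ρ<l , R

lemma3p1 : (m : ℕ) {{_ : NonZero m}} (a : Fin m) (S : Subset m) (b : Fin m) →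
    toℕ a ≢ 0 → toℕ b ≢ 0 → 0ₘ ∈ S →
    Connected (± a) S (± b) →
    5 < m → 2 ≤ ∣ S ∣ → 1 < gcdSet m S →
    2 * toℕ a ≢ m → 2 * toℕ b ≢ m →
    Coprime (toℕ a) (gcdSet m S) → Coprime (toℕ b) (gcdSet m S) →
    ¬ CongMod (gcdSet m S) (ℤ.+ toℕ b) (ℤ.+ toℕ a) →
    ¬ CongMod (gcdSet m S) (ℤ.+ toℕ b) (ℤ.- (ℤ.+ toℕ a)) →
    let d = gcdSet m S in
    (∃ λ l → ∃ λ μ → ∃ λ ρ → 1 ≤ l × 1 < μ × μ < d × ρ < l × NonUniformRep a S b l μ ρ)
    × (∃ λ h → 1 < h × h < d ∸ 1 × CongMod d (ℤ.+ toℕ b) (ℤ.+ h ℤ.* ℤ.+ toℕ a))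
    × (∀ h → 1 < h → h < d ∸ 1 → CongMod d (ℤ.+ toℕ b) (ℤ.+ h ℤ.* ℤ.+ toℕ a) →
        let hs = h ⊓ (d ∸ h) in
        ∃ λ μ → ∃ λ ρ → d ≡ μ * hs + suc ρ × suc ρ < hs ×
          1 ≤ hs ∸ 1 × 1 < μ × μ < d × ρ < hs ∸ 1 × NonUniformRep a S b (hs ∸ 1) μ ρ)
lemma3p1 m a S b _ _ 0∈S _ _ _ 1<d _ _ coprime-a coprime-b b≢a b≢-a =
  some-representation (solution b≢a b≢-a) , solution b≢a b≢-a , representation
  where open UnitSteps 0∈S 1<d coprime-a coprime-b
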